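{- Let $n\ge 1$ and $\sigma\in S_n$. The following are equivalent: (1) $M(\sigma)=I(\sigma)$ (equivalently, $H(\sigma)=\sigma$); (2) $I(\sigma)=(t_1(\sigma),\ldots,t_n(\sigma))$ satisfies $t_i(\sigma)\in\{0,i-1\}$ for each $i\in[n]$.
   Context: $S_n$ is the set of permutations of $[n]$ in one-line notation. Cyclic intervals: for $x,y\in[n]$, $\rrbracket x,y\rrbracket=\{z\in[n]:x<z\le y\}$ if $x\le y$, and $\{z\in[n]: z>x\text{ or }z\le y\}$ if $x>y$; $\rrbracket x,\infty\rrbracket=\{z\in[n]:z>x\}$. For $\sigma\in S_n$, $t_i(\sigma)=\#\{j<i:\sigma_j>\sigma_i\}$ and $s_i(\sigma)=\#\{j<i:\sigma_j\in\rrbracket\sigma_i,\sigma_{i+1}\rrbracket\}$ with $\sigma_{n+1}=\infty$; $I(\sigma)=(t_1(\sigma),\ldots,t_n(\sigma))$ (inversion code), $M(\sigma)=(s_1(\sigma),\ldots,s_n(\sigma))$ (cyclic major code). Han's map: for $x\in[n]$ and a permutation $\sigma=\sigma_1\cdots\sigma_{n-1}$ of $[n]\setminus\{x\}$, $C^x(\sigma)=\tau_1\cdots\tau_{n-1}$ with $\tau_i=\sigma_i-x+n$ if $\sigma_i<x$, $\tau_i=\sigma_i-x$ if $\sigma_i>x$; $C_x(\sigma)=\nu_1\cdots\nu_{n-1}$ with $\nu_i=\sigma_i$ if $\sigma_i<x$, $\nu_i=\sigma_i-1$ if $\sigma_i>x$; $H(1)=1$ and for $n>1$, $H(\sigma)=C_{\sigma_n}^{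 -1}\big(H(C^{\sigma_n}(\sigma_1\cdots\sigma_{n-1}))\big)\cdot\sigma_n$. (It holds that $H=I^{ -1}\circ M$, so $H(\sigma)=\sigma$ iff $M(\sigma)=I(\sigma)$.) -}

module Defs where

open import Data.Nat using (ℕ; zero; suc; _<_; _≤_; _<ᵇ_; _<?_)
open import Relation.Nullary using (yes; no)
open import Data.Bool using (Bool; true; false; _∧_; _∨_; not; if_then_else_)
open import Data.Fin using (Fin; toℕ; fromℕ<; inject₁)
open import Data.Fin.Properties using ()
open import Data.List using (List; length; filter; map)
open import Data.List using (allFin)
open import Data.Vec.Functional using (Vector)
open import Function.Definitions using (Injective)
open import Relation.Binary.PropositionalEquality using (_≡_)

-- Convention: a permutation of [n] in one-line notation is an injective
-- map σ : Fin n → Fin n (position i ↦ σ(i)); positions and values are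
-- 0-based (position i here is position i+1 in the paper, value v here is
-- value v+1).  All definitions below only use comparisons of values, which
-- are invariant under this uniform shift.

IsPerm : (n : ℕ) → (Fin n → Fin n) → Set
IsPerm n σ = Injective _≡_ _≡_ σ

_<?ᵇ_ : ℕ → ℕ → Bool
a <?ᵇ b = a <ᵇ b

_≤?ᵇ_ : ℕ → ℕ → Bool
a ≤?ᵇ b = a <ᵇ suc b

inCyc : ℕ → ℕ → ℕ → Bool
inCyc x y z = if x ≤?ᵇ y then (x <?ᵇ z) ∧ (z ≤?ᵇ y)
                         else (x <?ᵇ z) ∨ (z ≤?ᵇ y)

countBefore : {n : ℕ} → (Fin n → Fin n) → Fin n → (ℕ → Bool) → ℕ
countBefore {n} σ i p =
  length (filter (λ j → Data.Bool._≟_ ((toℕ j <?ᵇ toℕ i) ∧ p (toℕ (σ j))) true) (allFin n))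

t : {n : ℕ} → (Fin n → Fin n) → Fin n → ℕ
t σ i = countBefore σ i (λ z → toℕ (σ i) <?ᵇ z)

-- s_i(σ) = #{ j < i : σ_j ∈ ]σ_i, σ_{i+1}] }, with σ_{n+1} = ∞, where
-- ]x, ∞] = { z : z > x }
s : {n : ℕ} → (Fin n → Fin n) → Fin n → ℕ
s {n} σ i with suc (toℕ i) <? n
... | yes i+1<n = countBefore σ i (inCyc (toℕ (σ i)) (toℕ (σ (fromℕ< i+1<n))))
... | no _      = countBefore σ i (λ z → toℕ (σ i) <?ᵇ z)

I : {n : ℕ} → (Fin n → Fin n) → Vector ℕ n
I σ = t σ

M : {n : ℕ} → (Fin n → Fin n) → Vector ℕ n
M σ = s σ

_≋_ : {n : ℕ} → Vector ℕ n → Vector ℕ n → Set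
_≋_ {n} u v = (i : Fin n) → u i ≡ v i

-- With 0-based positions, t_i ∈ {0, i} says that σ_i is a left-to-right
-- maximum or minimum (a record). At a record i the test σ_j > σ_i counted by t_i has the
-- same outcome for all j < i, so s_i = t_i iff the cyclic test σ_j ∈ ]σ_i, σ_{i+1}] agrees
-- with it for every j < i. For values distinct from σ_{i+1} this agreement means that σ_j
-- lies on the same side of σ_{i+1} as σ_i, so, given that i is a record, s_i = t_i iff i+1
-- is a record as well. Position 0 is always a record and s = t at the last position, so
-- induction along the positions yields both implications.

module Submission where

open import Defs
open import Data.Bool using (Bool; true; false; _∧_; if_then_else_)
open import Data.Bool.Properties using (∧-identityʳ; ∨-identityʳ)
import Data.Bool as Bool
open import Data.Empty using (⊥-elim)
open import Data.Fin using (Fin; zero; suc; toℕ; inject₁; lower₁)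
open import Data.Fin.Induction using (<-weakInduction)
open import Data.Fin.Properties
  using (toℕ-injective; toℕ<n; toℕ-fromℕ<; toℕ-inject₁; inject₁ℕ<; inject₁-lower₁;
         ≤̄⇒inject₁<)
open import Data.List using (length; filter; tabulate)
open import Data.Nat using (ℕ; zero; suc; _<ᵇ_; _<_; _≤_; _<?_; z≤n; s≤s; z<s; s<s; s≤s⁻¹)
import Data.Nat as ℕ
open import Data.Nat.Properties
  using (<-cmp; ≤-refl; ≤⇒≯; <⇒≤; <⇒≢; <-trans; 1+n≰n; m≤n⇒m≤1+n; m≤n⇒m<n∨m≡n;
         suc-injective; n≮n)
open import Data.Product using (_×_; _,_; ∃-syntax)
open import Data.Sum using (_⊎_; inj₁; inj₂; [_,_])
open import Function using (_∘_; id)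
open import Function.Bundles using (_⇔_; mk⇔; Equivalence)
import Function.Properties.Equivalence as ⇔
open import Relation.Binary using (tri<; tri≈; tri>)
open import Relation.Binary.PropositionalEquality
  using (_≡_; _≢_; refl; sym; trans; cong; subst)
open import Relation.Nullary using (yes; no; contradiction)
open import Relation.Nullary.Decidable using (dec-true; dec-false)

open Equivalence using (to; from)

-- both rely on `does (m <? n)` computing to `m <ᵇ n`
<⇒<ᵇ≡true : ∀ {m n} → m < n → (m <ᵇ n) ≡ true
<⇒<ᵇ≡true {m} {n} = dec-true (m <? n)

≤⇒<ᵇ≡false : ∀ {m n} → n ≤ m → (m <ᵇ n) ≡ false
≤⇒<ᵇ≡false {m} {n} n≤m = dec-false (m <? n) (≤⇒≯ n≤m)

count : ∀ {n} → (Fin n → Bool) → ℕ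
count {zero}  f = 0
count {suc n} f = (if f zero then 1 else 0) ℕ.+ count (f ∘ suc)

count-tabulate : ∀ {m n} (f : Fin m → Bool) (g : Fin n → Fin m) →
  length (filter (λ j → f j Bool.≟ true) (tabulate g)) ≡ count (f ∘ g)
count-tabulate {n = zero}  f g = refl
count-tabulate {n = suc n} f g with f (g zero)
... | true  = cong suc (count-tabulate f (g ∘ suc))
... | false = count-tabulate f (g ∘ suc)

below : ∀ {n} → ℕ → (Fin n → Bool) → Fin n → Bool
below k q j = (toℕ j <ᵇ k) ∧ q j

count-below-≤ : ∀ {n} k (q : Fin n → Bool) → count (below k q) ≤ k
count-below-≤ {zero}  k       q = z≤n
count-below-≤ {suc n} zero    q = count-below-≤ zero (q ∘ suc)
count-below-≤ {suc n} (suc k) q with q zero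
... | true  = s≤s (count-below-≤ k (q ∘ suc))
... | false = m≤n⇒m≤1+n (count-below-≤ k (q ∘ suc))

all-below-suc⇔ : ∀ {n k} (q : Fin (suc n) → Bool) {b} → q zero ≡ b →
  (∀ j → toℕ j < k → q (suc j) ≡ b) ⇔ (∀ j → toℕ j < suc k → q j ≡ b)
all-below-suc⇔ q q₀ = mk⇔ (λ h → λ { zero _ → q₀ ; (suc j) (s<s j<k) → h j j<k })
                          (λ h j j<k → h (suc j) (s<s j<k))

count-below-≡⇔ : ∀ {n} k (q : Fin n → Bool) (b : Bool) → k ≤ n →
  count (below k q) ≡ (if b then k else 0) ⇔ (∀ j → toℕ j < k → q j ≡ b)
count-below-≡⇔ {zero} zero q true  z≤n = mk⇔ (λ _ ()) (λ _ → refl)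
count-below-≡⇔ {zero} zero q false z≤n = mk⇔ (λ _ ()) (λ _ → refl)
count-below-≡⇔ {suc n} zero q b z≤n =
  mk⇔ (λ _ _ ()) (λ _ → from (count-below-≡⇔ zero (q ∘ suc) b z≤n) (λ _ ()))
count-below-≡⇔ {suc n} (suc k) q b (s≤s k≤n) with q zero in q₀ | b
... | true  | true  = ⇔.trans (mk⇔ suc-injective (cong suc))
                        (⇔.trans (count-below-≡⇔ k (q ∘ suc) true k≤n) (all-below-suc⇔ q q₀))
... | false | false = ⇔.trans (count-below-≡⇔ k (q ∘ suc) false k≤n) (all-below-suc⇔ q q₀)
... | true  | false = mk⇔ (λ ()) (λ h → contradiction (trans (sym q₀) (h zero z<s)) λ ())
... | false | true  = mk⇔
  (λ e → ⊥-elim (1+n≰n (subst (_≤ k) e (count-below-≤ k (q ∘ suc)))))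
  (λ h → contradiction (trans (sym q₀) (h zero z<s)) λ ())

inCyc-< : ∀ {x y z} → x < y → inCyc x y z ≡ (x <ᵇ z) ∧ (z <ᵇ suc y)
inCyc-< x<y rewrite <⇒<ᵇ≡true (m≤n⇒m≤1+n x<y) = refl

inCyc-> : ∀ {x y z} → y < x → inCyc x y z ≡ (x <ᵇ z) Bool.∨ (z <ᵇ suc y)
inCyc-> y<x rewrite ≤⇒<ᵇ≡false y<x = refl

inCyc≡<ᵇ⇔ : ∀ {x y z} → x ≢ y → z ≢ y → inCyc x y z ≡ (x <ᵇ z) ⇔ (y <ᵇ z) ≡ (y <ᵇ x)
inCyc≡<ᵇ⇔ {x} {y} {z} x≢y z≢y with <-cmp x y | <-cmp y z
... | tri≈ _ x≡y _ | _              = contradiction x≡y x≢y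
... | _            | tri≈ _ y≡z _   = contradiction (sym y≡z) z≢y
... | tri< x<y _ _ | tri< y<z _ _
  rewrite inCyc-< {z = z} x<y | ≤⇒<ᵇ≡false {z} {suc y} y<z
        | <⇒<ᵇ≡true (<-trans x<y y<z) | <⇒<ᵇ≡true y<z | ≤⇒<ᵇ≡false (<⇒≤ x<y)
  = mk⇔ (λ ()) (λ ())
... | tri< x<y _ _ | tri> _ _ z<y
  rewrite inCyc-< {z = z} x<y | <⇒<ᵇ≡true {z} {suc y} (m≤n⇒m≤1+n z<y)
        | ∧-identityʳ (x <ᵇ z) | ≤⇒<ᵇ≡false (<⇒≤ z<y) | ≤⇒<ᵇ≡false (<⇒≤ x<y)
  = mk⇔ (λ _ → refl) (λ _ → refl)
... | tri> _ _ y<x | tri< y<z _ _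
  rewrite inCyc-> {z = z} y<x | ≤⇒<ᵇ≡false {z} {suc y} y<z
        | ∨-identityʳ (x <ᵇ z) | <⇒<ᵇ≡true y<z | <⇒<ᵇ≡true y<x
  = mk⇔ (λ _ → refl) (λ _ → refl)
... | tri> _ _ y<x | tri> _ _ z<y
  rewrite inCyc-> {z = z} y<x | <⇒<ᵇ≡true {z} {suc y} (m≤n⇒m≤1+n z<y)
        | ≤⇒<ᵇ≡false (<⇒≤ (<-trans z<y y<x)) | ≤⇒<ᵇ≡false (<⇒≤ z<y) | <⇒<ᵇ≡true y<x
  = mk⇔ (λ ()) (λ ())

module _ {N : ℕ} (σ : Fin N → Fin N) where

  IsRecord : Fin N → Set
  IsRecord i = ∃[ b ] ∀ k → toℕ k < toℕ i → (toℕ (σ i) <ᵇ toℕ (σ k)) ≡ b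

  countBefore≡count : ∀ i p → countBefore σ i p ≡ count (below (toℕ i) (p ∘ toℕ ∘ σ))
  countBefore≡count i p = count-tabulate (below (toℕ i) (p ∘ toℕ ∘ σ)) id

  countBefore-≡⇔ : ∀ i p b → countBefore σ i p ≡ (if b then toℕ i else 0)
                             ⇔ (∀ k → toℕ k < toℕ i → p (toℕ (σ k)) ≡ b)
  countBefore-≡⇔ i p b rewrite countBefore≡count i p =
    count-below-≡⇔ (toℕ i) (p ∘ toℕ ∘ σ) b (<⇒≤ (toℕ<n i))

  countBefore-≡-constant⇔ : ∀ i p q b → (∀ k → toℕ k < toℕ i → q (toℕ (σ k)) ≡ b) →
    countBefore σ i p ≡ countBefore σ i q ⇔ (∀ k → toℕ k < toℕ i → p (toℕ (σ k)) ≡ q (toℕ (σ k)))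
  countBefore-≡-constant⇔ i p q b q≡b = mk⇔
    (λ e k k<i → trans (to P (trans e Q) k k<i) (sym (q≡b k k<i)))
    (λ p≡q → trans (from P (λ k k<i → trans (p≡q k k<i) (q≡b k k<i))) (sym Q))
    where
    P : countBefore σ i p ≡ (if b then toℕ i else 0) ⇔ (∀ k → toℕ k < toℕ i → p (toℕ (σ k)) ≡ b)
    P = countBefore-≡⇔ i p b
    Q : countBefore σ i q ≡ (if b then toℕ i else 0)
    Q = from (countBefore-≡⇔ i q b) q≡b

  t-extreme⇔IsRecord : ∀ i → (t σ i ≡ 0 ⊎ t σ i ≡ toℕ i) ⇔ IsRecord i
  t-extreme⇔IsRecord i = mk⇔
    (λ { (inj₁ t≡0) → false , to (t≡⇔ false) t≡0 ; (inj₂ t≡i) → true , to (t≡⇔ true) t≡i })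
    (λ { (false , h) → inj₁ (from (t≡⇔ false) h) ; (true , h) → inj₂ (from (t≡⇔ true) h) })
    where
    t≡⇔ : ∀ b → t σ i ≡ (if b then toℕ i else 0)
                 ⇔ (∀ k → toℕ k < toℕ i → (toℕ (σ i) <ᵇ toℕ (σ k)) ≡ b)
    t≡⇔ = countBefore-≡⇔ i (toℕ (σ i) <ᵇ_)

<suc⇒<inject₁⊎≡inject₁ : ∀ {n} {j : Fin n} (k : Fin (suc n)) → toℕ k < toℕ (suc j) →
  toℕ k < toℕ (inject₁ j) ⊎ k ≡ inject₁ j
<suc⇒<inject₁⊎≡inject₁ {j = j} k k<suc-j with m≤n⇒m<n∨m≡n (s≤s⁻¹ k<suc-j)
... | inj₁ k<j = inj₁ (subst (toℕ k <_) (sym (toℕ-inject₁ j)) k<j)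
... | inj₂ k≡j = inj₂ (toℕ-injective (trans k≡j (sym (toℕ-inject₁ j))))

module _ {n : ℕ} (σ : Fin (suc n) → Fin (suc n)) (σ-inj : IsPerm (suc n) σ) where

  private
    v : Fin (suc n) → ℕ
    v k = toℕ (σ k)

    inject₁<suc : ∀ j → toℕ (inject₁ j) < toℕ (suc {n} j)
    inject₁<suc j = ≤̄⇒inject₁< ≤-refl

    v-distinct : ∀ {k l} → toℕ k < toℕ l → v k ≢ v l
    v-distinct k<l e = <⇒≢ k<l (cong toℕ (σ-inj (toℕ-injective e)))

  IsRecord-zero : IsRecord σ zero
  IsRecord-zero = false , λ _ ()

  IsRecord-suc⇔ : ∀ j → IsRecord σ (suc j) ⇔
    (∀ k → toℕ k < toℕ (inject₁ j) → (v (suc j) <ᵇ v k) ≡ (v (suc j) <ᵇ v (inject₁ j)))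
  IsRecord-suc⇔ j = mk⇔
    (λ (b , h) k k<i →
      trans (h k (<-trans k<i (inject₁<suc j))) (sym (h (inject₁ j) (inject₁<suc j))))
    (λ h → (v (suc j) <ᵇ v (inject₁ j)) , λ k k<suc-j →
      [ h k , cong (λ m → v (suc j) <ᵇ v m) ] (<suc⇒<inject₁⊎≡inject₁ k k<suc-j))

  s-inject₁ : ∀ j →
    s σ (inject₁ j) ≡ countBefore σ (inject₁ j) (inCyc (v (inject₁ j)) (v (suc j)))
  s-inject₁ j with suc (toℕ (inject₁ j)) <? suc n
  ... | yes p = cong (λ m → countBefore σ (inject₁ j) (inCyc (v (inject₁ j)) (v m)))
                     (toℕ-injective (trans (toℕ-fromℕ< p) (cong suc (toℕ-inject₁ j))))
  ... | no ¬p = contradiction (s<s (inject₁ℕ< j)) ¬p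

  s-last : ∀ i → toℕ i ≡ n → s σ i ≡ t σ i
  s-last i i≡n with suc (toℕ i) <? suc n
  ... | yes p = contradiction (subst (_< n) i≡n (s≤s⁻¹ p)) (n≮n n)
  ... | no _  = refl

  s≡t⇔IsRecord-suc : ∀ j → IsRecord σ (inject₁ j) →
    s σ (inject₁ j) ≡ t σ (inject₁ j) ⇔ IsRecord σ (suc j)
  s≡t⇔IsRecord-suc j (b , i-record) rewrite s-inject₁ j =
    ⇔.trans (countBefore-≡-constant⇔ σ i (inCyc x y) (x <ᵇ_) b i-record)
    (⇔.trans (mk⇔ (λ h k k<i → to (agree⇔ k k<i) (h k k<i))
                  (λ h k k<i → from (agree⇔ k k<i) (h k k<i)))
             (⇔.sym (IsRecord-suc⇔ j)))
    where
    i : Fin (suc n)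
    i = inject₁ j
    x y : ℕ
    x = v i
    y = v (suc j)
    agree⇔ : ∀ k → toℕ k < toℕ i → inCyc x y (v k) ≡ (x <ᵇ v k) ⇔ (y <ᵇ v k) ≡ (y <ᵇ x)
    agree⇔ k k<i =
      inCyc≡<ᵇ⇔ (v-distinct (inject₁<suc j)) (v-distinct (<-trans k<i (inject₁<suc j)))

  s≡t⇔all-IsRecord : (∀ i → s σ i ≡ t σ i) ⇔ (∀ i → IsRecord σ i)
  s≡t⇔all-IsRecord = mk⇔ all-records all-s≡t
    where
    all-records : (∀ i → s σ i ≡ t σ i) → ∀ i → IsRecord σ i
    all-records s≡t = <-weakInduction (IsRecord σ) IsRecord-zero
      (λ j j-record → to (s≡t⇔IsRecord-suc j j-record) (s≡t (inject₁ j)))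

    all-s≡t : (∀ i → IsRecord σ i) → ∀ i → s σ i ≡ t σ i
    all-s≡t records i with n ℕ.≟ toℕ i
    ... | yes n≡i = s-last i (sym n≡i)
    ... | no  n≢i = subst (λ i → s σ i ≡ t σ i) (inject₁-lower₁ i n≢i)
                      (from (s≡t⇔IsRecord-suc j (records (inject₁ j))) (records (suc j)))
      where
      j : Fin n
      j = lower₁ i n≢i

corollary3p2 : (n : ℕ) → (σ : Fin (suc n) → Fin (suc n)) → IsPerm (suc n) σ →
    ((M σ ≋ I σ → (i : Fin (suc n)) → (t σ i ≡ 0 ⊎ t σ i ≡ toℕ i))
    × (((i : Fin (suc n)) → (t σ i ≡ 0 ⊎ t σ i ≡ toℕ i)) → M σ ≋ I σ))
corollary3p2 n σ σ-inj =
  (λ M≋I i → from (t-extreme⇔IsRecord σ i) (to records⇔ M≋I i)) ,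
  (λ t-extreme → from records⇔ (λ i → to (t-extreme⇔IsRecord σ i) (t-extreme i)))
  where
  records⇔ : (∀ i → s σ i ≡ t σ i) ⇔ (∀ i → IsRecord σ i)
  records⇔ = s≡t⇔all-IsRecord σ σ-inj
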